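{- If $n$ is a non-negative integer and $r$ and $s$ are integers, then \[ 10\sum_{k = 0}^{\lfloor n/2 \rfloor } \binom n{2k}F_{k + r} F_{k + s} = L_{2n + r + s} + ( - 1)^{r + s} L_{n - r - s}- ( - 1)^s 2^{n/2+1} \cos\Big(\frac{n\pi}{4}\Big)L_{r - s}, \] \[ 2\sum_{k = 0}^{\lfloor n/2 \rfloor } \binom n{2k}L_{k + r} F_{k + s} = F_{2n + r + s} - ( - 1)^{r + s} F_{n - r - s}- ( - 1)^s 2^{n/2+1} \cos\Big(\frac{n\pi}{4}\Big)F_{r - s}, \] \[ 2\sum_{k = 0}^{\lfloor n/2 \rfloor } \binom n{2k}L_{k + r} L_{k + s} = L_{2n + r + s} + ( - 1)^{r + s} L_{n - r - s} + ( - 1)^s 2^{n/2+1} \cos\Big(\frac{n\pi}{4}\Big)L_{r - s}. \]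
   Context: The Fibonacci numbers $F_j$ and Lucas numbers $L_j$ are defined for all integers $j$ by $F_0=0$, $F_1=1$, $L_0=2$, $L_1=1$, $F_j=F_{j-1}+F_{j-2}$, $L_j=L_{j-1}+L_{j-2}$, with $F_{ -j}=(-1)^{j-1}F_j$ and $L_{ -j}=(-1)^jL_j$. -}

module Defs where

open import Data.Nat as ℕ using (ℕ; zero; suc; ⌊_/2⌋)
open import Data.Nat.Combinatorics using (_C_)
open import Data.Integer using (ℤ; +_; -[1+_]; _+_; _-_; _*_; -_; ∣_∣)
open import Data.Product using (_×_; _,_; proj₁)

fibℕ : ℕ → ℕ
fibℕ zero = 0
fibℕ (suc zero) = 1
fibℕ (suc (suc n)) = fibℕ (suc n) ℕ.+ fibℕ n

lucℕ : ℕ → ℕ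
lucℕ zero = 2
lucℕ (suc zero) = 1
lucℕ (suc (suc n)) = lucℕ (suc n) ℕ.+ lucℕ n

negOnePowℕ : ℕ → ℤ
negOnePowℕ zero = + 1
negOnePowℕ (suc m) = - negOnePowℕ m

negOnePow : ℤ → ℤ
negOnePow m = negOnePowℕ ∣ m ∣

-- F_j, L_j for all integers j, with F_{-j} = (-1)^{j-1} F_j, L_{-j} = (-1)^j L_j
F : ℤ → ℤ
F (+ n) = + fibℕ n
F -[1+ n ] = negOnePowℕ n * + fibℕ (suc n)

L : ℤ → ℤ
L (+ n) = + lucℕ n
L -[1+ n ] = negOnePowℕ (suc n) * + lucℕ (suc n)

sumTo : ℕ → (ℕ → ℤ) → ℤ
sumTo zero f = f 0
sumTo (suc m) f = sumTo m f + f (suc m)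

-- Gaussian integers a + b i as pairs (a , b)
gmul : ℤ × ℤ → ℤ × ℤ → ℤ × ℤ
gmul (a , b) (c , d) = (a * c - b * d , a * d + b * c)

gpow : ℤ × ℤ → ℕ → ℤ × ℤ
gpow z zero = (+ 1 , + 0)
gpow z (suc n) = gmul z (gpow z n)

-- cosTerm n = 2^{n/2+1} cos(nπ/4) = 2 · Re((1+i)^n), since (1+i)^n = 2^{n/2} e^{inπ/4}
cosTerm : ℕ → ℤ
cosTerm n = + 2 * proj₁ (gpow (+ 1 , + 1) n)

binom : ℕ → ℕ → ℤ
binom n k = + (n C k)

-- The product formulas 5 F_a F_b = L_{a+b} - (-1)^b L_{a-b}, L_a F_b = F_{a+b} - (-1)^b F_{a-b} and
-- L_a L_b = L_{a+b} + (-1)^b L_{a-b} turn each sum into Σ_k C(n,2k) X_{2k+m}, with m = r + s and X = F or L,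
-- plus a multiple of Σ_k C(n,2k) (-1)^k. The second sum is Re (1+i)^n. The first is half of
-- X_{2n+m} + (-1)^n X_{m-n} for every sequence X satisfying the Fibonacci recurrence, by Binet's formula and
-- 1 + α = α², 1 - α = β. Everything is proved without irrationals: a Fibonacci-like sequence on ℤ is determined
-- by two consecutive values, and the even binomial sums E_n g = Σ_k C(n,2k) g_k obey
-- E_{n+2} g = 2 E_{n+1} g - E_n g + E_n (g ∘ suc) by Pascal's rule, so it suffices to check that the claimed
-- closed forms satisfy the same recurrences and initial values.

module Submission where

open import Algebra.Bundles using (AbelianGroup)
open import Data.Integer using (ℤ; +_; -[1+_]; _+_; _-_; _*_; -_; ∣_∣)
import Data.Integer.Properties as ℤₚ
open import Algebra.Properties.Group (AbelianGroup.group ℤₚ.+-0-abelianGroup) using (∙-cancelˡ)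
open import Data.Integer.Tactic.RingSolver using (solve-∀)
open import Data.Nat as ℕ using (ℕ; zero; suc; ⌊_/2⌋; _<_; z≤n; s≤s; _≤′_; ≤′-refl; ≤′-step)
import Data.Nat.Properties as ℕₚ
open import Data.Nat.Combinatorics using (nCk+nC[k+1]≡[n+1]C[k+1]; k>n⇒nCk≡0)
open import Data.Product using (_×_; _,_; proj₁; proj₂)
open import Function using (_∘_)
open import Relation.Binary.PropositionalEquality
open ≡-Reasoning

open import Defs

negOnePow-suc : ∀ j → negOnePow (+ 1 + j) ≡ - negOnePow j
negOnePow-suc (+ n)        = refl
negOnePow-suc -[1+ zero ]  = refl
negOnePow-suc -[1+ suc n ] = sym (ℤₚ.neg-involutive (- negOnePowℕ n))

negOnePow-+ : ∀ k j → negOnePow (+ k + j) ≡ negOnePowℕ k * negOnePow j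
negOnePow-+ zero    j = trans (cong negOnePow (ℤₚ.+-identityˡ j)) (sym (ℤₚ.*-identityˡ _))
negOnePow-+ (suc k) j = begin
  negOnePow (+ 1 + + k + j)       ≡⟨ cong negOnePow (ℤₚ.+-assoc (+ 1) (+ k) j) ⟩
  negOnePow (+ 1 + (+ k + j))     ≡⟨ negOnePow-suc (+ k + j) ⟩
  - negOnePow (+ k + j)           ≡⟨ cong -_ (negOnePow-+ k j) ⟩
  - (negOnePowℕ k * negOnePow j)  ≡⟨ ℤₚ.neg-distribˡ-* (negOnePowℕ k) (negOnePow j) ⟩
  - negOnePowℕ k * negOnePow j    ∎

negOnePow-neg : ∀ j → negOnePow (- j) ≡ negOnePow j
negOnePow-neg j = cong negOnePowℕ (ℤₚ.∣-i∣≡∣i∣ j)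

negOnePowℕ-square : ∀ k → negOnePowℕ k * negOnePowℕ k ≡ + 1
negOnePowℕ-square zero    = refl
negOnePowℕ-square (suc k) = trans (neg*neg (negOnePowℕ k)) (negOnePowℕ-square k)
  where
  neg*neg : ∀ x → - x * - x ≡ x * x
  neg*neg = solve-∀

record FibonacciLike (X : ℤ → ℤ) : Set where
  constructor fibonacciLike
  field recurrence : ∀ j → X (+ 2 + j) ≡ X (+ 1 + j) + X j

open FibonacciLike

fibonacciLike-F : FibonacciLike F
fibonacciLike-F = fibonacciLike F-recurrence
  where
  expand : ∀ σ a b → σ * a ≡ - σ * (a + b) + - - σ * (a + b + a)
  expand = solve-∀
  F-recurrence : ∀ j → F (+ 2 + j) ≡ F (+ 1 + j) + F j
  F-recurrence (+ n)              = refl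
  F-recurrence -[1+ zero ]        = refl
  F-recurrence -[1+ suc zero ]    = refl
  F-recurrence -[1+ suc (suc k) ] = expand (negOnePowℕ k) (+ fibℕ (suc k)) (+ fibℕ k)

fibonacciLike-L : FibonacciLike L
fibonacciLike-L = fibonacciLike L-recurrence
  where
  expand : ∀ σ a b → - σ * a ≡ - - σ * (a + b) + - - - σ * (a + b + a)
  expand = solve-∀
  L-recurrence : ∀ j → L (+ 2 + j) ≡ L (+ 1 + j) + L j
  L-recurrence (+ n)              = refl
  L-recurrence -[1+ zero ]        = refl
  L-recurrence -[1+ suc zero ]    = refl
  L-recurrence -[1+ suc (suc k) ] = expand (negOnePowℕ k) (+ lucℕ (suc k)) (+ lucℕ k)

module _ {X : ℤ → ℤ} (fibX : FibonacciLike X) where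

  fibonacciLike-shiftˡ : ∀ c → FibonacciLike (λ j → X (c + j))
  fibonacciLike-shiftˡ c = fibonacciLike λ j → begin
    X (c + (+ 2 + j))             ≡⟨ cong X (left-comm c (+ 2) j) ⟩
    X (+ 2 + (c + j))             ≡⟨ recurrence fibX (c + j) ⟩
    X (+ 1 + (c + j)) + X (c + j) ≡⟨ cong (λ i → X i + X (c + j)) (left-comm (+ 1) c j) ⟩
    X (c + (+ 1 + j)) + X (c + j) ∎
    where
    left-comm : ∀ a b j → a + (b + j) ≡ b + (a + j)
    left-comm = solve-∀

  fibonacciLike-shiftʳ : ∀ c → FibonacciLike (λ j → X (j + c))
  fibonacciLike-shiftʳ c = fibonacciLike λ j → begin
    X (+ 2 + j + c)                 ≡⟨ cong X (ℤₚ.+-assoc (+ 2) j c) ⟩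
    X (+ 2 + (j + c))               ≡⟨ recurrence fibX (j + c) ⟩
    X (+ 1 + (j + c)) + X (j + c)   ≡⟨ cong (λ i → X i + X (j + c)) (ℤₚ.+-assoc (+ 1) j c) ⟨
    X (+ 1 + j + c) + X (j + c)     ∎

  fibonacciLike-*ˡ : ∀ c → FibonacciLike (λ j → c * X j)
  fibonacciLike-*ˡ c = fibonacciLike λ j →
    trans (cong (c *_) (recurrence fibX j)) (ℤₚ.*-distribˡ-+ c (X (+ 1 + j)) (X j))

  fibonacciLike-*ʳ : ∀ c → FibonacciLike (λ j → X j * c)
  fibonacciLike-*ʳ c = fibonacciLike λ j →
    trans (cong (_* c) (recurrence fibX j)) (ℤₚ.*-distribʳ-+ c (X (+ 1 + j)) (X j))

  fibonacciLike-neg : FibonacciLike (λ j → - X j)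
  fibonacciLike-neg = fibonacciLike λ j →
    trans (cong -_ (recurrence fibX j)) (ℤₚ.neg-distrib-+ (X (+ 1 + j)) (X j))

  fibonacciLike-+4 : ∀ j → X (+ 4 + j) ≡ + 3 * X (+ 1 + j) + + 2 * X j
  fibonacciLike-+4 j = begin
    X (+ 4 + j)                                           ≡⟨ shifted 2 ⟩
    X (+ 3 + j) + X (+ 2 + j)                             ≡⟨ cong (_+ X (+ 2 + j)) (shifted 1) ⟩
    X (+ 2 + j) + X (+ 1 + j) + X (+ 2 + j)               ≡⟨ cong (λ x → x + X (+ 1 + j) + x) (recurrence fibX j) ⟩
    X (+ 1 + j) + X j + X (+ 1 + j) + (X (+ 1 + j) + X j) ≡⟨ collect (X (+ 1 + j)) (X j) ⟩
    + 3 * X (+ 1 + j) + + 2 * X j                         ∎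
    where
    shifted : ∀ d → X (+ 2 + + d + j) ≡ X (+ 1 + + d + j) + X (+ d + j)
    shifted d = begin
      X (+ 2 + + d + j)                 ≡⟨ cong X (ℤₚ.+-assoc (+ 2) (+ d) j) ⟩
      X (+ 2 + (+ d + j))               ≡⟨ recurrence fibX (+ d + j) ⟩
      X (+ 1 + (+ d + j)) + X (+ d + j) ≡⟨ cong (λ i → X i + X (+ d + j)) (ℤₚ.+-assoc (+ 1) (+ d) j) ⟨
      X (+ 1 + + d + j) + X (+ d + j)   ∎
    collect : ∀ a b → a + b + a + (a + b) ≡ + 3 * a + + 2 * b
    collect = solve-∀

  -- If X j = a αʲ + b βʲ then (-1)ʲ X (-j) = b αʲ + a βʲ, since αβ = -1.
  fibonacciLike-conjugate : FibonacciLike (λ j → negOnePow j * X (- j))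
  fibonacciLike-conjugate = fibonacciLike λ j → let s = negOnePow j; u = - (+ 2 + j) in begin
    negOnePow (+ 2 + j) * X u                    ≡⟨ cong (_* X u) (negOnePow-+ 2 j) ⟩
    + 1 * s * X u                                ≡⟨ rearrange s (X (- (+ 1 + j))) (X u) ⟩
    - s * X (- (+ 1 + j)) + s * (X (- (+ 1 + j)) + X u)
      ≡⟨ cong₂ (λ t y → t * X (- (+ 1 + j)) + s * y) (negOnePow-suc j) (reflected j) ⟨
    negOnePow (+ 1 + j) * X (- (+ 1 + j)) + s * X (- j) ∎
    where
    rearrange : ∀ s a b → + 1 * s * b ≡ - s * a + s * (a + b)
    rearrange = solve-∀
    two-minus : ∀ j → + 2 + - (+ 2 + j) ≡ - j
    two-minus = solve-∀
    one-minus : ∀ j → + 1 + - (+ 2 + j) ≡ - (+ 1 + j)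
    one-minus = solve-∀
    reflected : ∀ j → X (- j) ≡ X (- (+ 1 + j)) + X (- (+ 2 + j))
    reflected j = let u = - (+ 2 + j) in begin
      X (- j)                 ≡⟨ cong X (two-minus j) ⟨
      X (+ 2 + u)             ≡⟨ recurrence fibX u ⟩
      X (+ 1 + u) + X u       ≡⟨ cong (λ i → X i + X u) (one-minus j) ⟩
      X (- (+ 1 + j)) + X u   ∎

fibonacciLike-+ : ∀ {X Y} → FibonacciLike X → FibonacciLike Y → FibonacciLike (λ j → X j + Y j)
fibonacciLike-+ {X} {Y} fibX fibY = fibonacciLike λ j →
  trans (cong₂ _+_ (recurrence fibX j) (recurrence fibY j))
        (interchange (X (+ 1 + j)) (X j) (Y (+ 1 + j)) (Y j))
  where
  interchange : ∀ a b c d → (a + b) + (c + d) ≡ (a + c) + (b + d)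
  interchange = solve-∀

fibonacciLike-unique : ∀ {X Y} → FibonacciLike X → FibonacciLike Y →
  X (+ 0) ≡ Y (+ 0) → X (+ 1) ≡ Y (+ 1) → ∀ j → X j ≡ Y j
fibonacciLike-unique {X} {Y} fibX fibY eq₀ eq₁ = agree
  where
  forward : ∀ j → X (+ 1 + j) ≡ Y (+ 1 + j) → X j ≡ Y j → X (+ 2 + j) ≡ Y (+ 2 + j)
  forward j eq eq′ = trans (recurrence fibX j) (trans (cong₂ _+_ eq eq′) (sym (recurrence fibY j)))

  backward : ∀ j → X (+ 2 + j) ≡ Y (+ 2 + j) → X (+ 1 + j) ≡ Y (+ 1 + j) → X j ≡ Y j
  backward j eq eq′ = ∙-cancelˡ (X (+ 1 + j)) (X j) (Y j)
    (trans (sym (recurrence fibX j)) (trans eq (trans (recurrence fibY j) (cong (_+ Y j) (sym eq′)))))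

  upward : ∀ n → X (+ n) ≡ Y (+ n) × X (+ suc n) ≡ Y (+ suc n)
  upward zero    = eq₀ , eq₁
  upward (suc n) with upward n
  ... | eqₙ , eqₙ₊₁ = eqₙ₊₁ , forward (+ n) eqₙ₊₁ eqₙ

  two-minus : ∀ i → + 2 + - (+ 1 + i) ≡ + 1 - i
  two-minus = solve-∀
  one-minus : ∀ i → + 1 + - (+ 1 + i) ≡ - i
  one-minus = solve-∀

  at : ∀ {i i′} → i ≡ i′ → X i ≡ Y i → X i′ ≡ Y i′
  at p = subst (λ i → X i ≡ Y i) p

  downward : ∀ n → X (- + n) ≡ Y (- + n) × X (+ 1 - + n) ≡ Y (+ 1 - + n)
  downward zero    = eq₀ , eq₁
  downward (suc n) with downward n
  ... | eqₙ , eqₙ₋₁ =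
    backward (- + suc n) (at (sym (two-minus (+ n))) eqₙ₋₁) (at (sym (one-minus (+ n))) eqₙ) ,
    at (sym (one-minus (+ n))) eqₙ

  agree : ∀ j → X j ≡ Y j
  agree (+ n)    = proj₁ (upward n)
  agree -[1+ n ] = proj₁ (downward (suc n))

ProductFormula : (P Q R : ℤ → ℤ) (c σ : ℤ) → ℤ → ℤ → Set
ProductFormula P Q R c σ a b = c * (P a * Q b) ≡ R (a + b) + σ * (negOnePow b * R (a - b))

productFormula-fromBase : ∀ {P Q R} (c σ : ℤ) → FibonacciLike P → FibonacciLike Q → FibonacciLike R →
  ProductFormula P Q R c σ (+ 0) (+ 0) → ProductFormula P Q R c σ (+ 0) (+ 1) →
  ProductFormula P Q R c σ (+ 1) (+ 0) → ProductFormula P Q R c σ (+ 1) (+ 1) →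
  ∀ a b → ProductFormula P Q R c σ a b
productFormula-fromBase {P} {Q} {R} c σ fibP fibQ fibR eq₀₀ eq₀₁ eq₁₀ eq₁₁ a =
  fibonacciLike-unique
    (fibonacciLike-*ˡ (fibonacciLike-*ˡ fibQ (P a)) c)
    (fibonacciLike-+ (fibonacciLike-shiftˡ fibR a)
                     (fibonacciLike-*ˡ (fibonacciLike-conjugate (fibonacciLike-shiftˡ fibR a)) σ))
    (in-first-argument (+ 0) eq₀₀ eq₁₀ a)
    (in-first-argument (+ 1) eq₀₁ eq₁₁ a)
  where
  in-first-argument : ∀ b → ProductFormula P Q R c σ (+ 0) b → ProductFormula P Q R c σ (+ 1) b →
    ∀ a → ProductFormula P Q R c σ a b
  in-first-argument b = fibonacciLike-unique
    (fibonacciLike-*ˡ (fibonacciLike-*ʳ fibP (Q b)) c)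
    (fibonacciLike-+ (fibonacciLike-shiftʳ fibR b)
                     (fibonacciLike-*ˡ (fibonacciLike-*ˡ (fibonacciLike-shiftʳ fibR (- b)) (negOnePow b)) σ))

FF-product : ∀ a b → ProductFormula F F L (+ 5) (- + 1) a b
FF-product = productFormula-fromBase (+ 5) (- + 1) fibonacciLike-F fibonacciLike-F fibonacciLike-L refl refl refl refl

LF-product : ∀ a b → ProductFormula L F F (+ 1) (- + 1) a b
LF-product = productFormula-fromBase (+ 1) (- + 1) fibonacciLike-L fibonacciLike-F fibonacciLike-F refl refl refl refl

LL-product : ∀ a b → ProductFormula L L L (+ 1) (+ 1) a b
LL-product = productFormula-fromBase (+ 1) (+ 1) fibonacciLike-L fibonacciLike-L fibonacciLike-L refl refl refl refl

L-conjugate : ∀ j → negOnePow j * L (- j) ≡ L j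
L-conjugate = fibonacciLike-unique (fibonacciLike-conjugate fibonacciLike-L) fibonacciLike-L refl refl

F-conjugate : ∀ j → negOnePow j * F (- j) ≡ - F j
F-conjugate = fibonacciLike-unique (fibonacciLike-conjugate fibonacciLike-F) (fibonacciLike-neg fibonacciLike-F) refl refl

conjugate-reflection : ∀ {X Y : ℤ → ℤ} → (∀ j → negOnePow j * X (- j) ≡ Y j) →
  ∀ n m → negOnePowℕ n * X (m - + n) ≡ negOnePow m * Y (+ n - m)
conjugate-reflection {X} {Y} conj n m = begin
  negOnePowℕ n * X (m - + n)                            ≡⟨ cong (λ i → negOnePowℕ n * X i) (neg-minus (+ n) m) ⟨
  negOnePowℕ n * X (- j)                                ≡⟨ ℤₚ.*-identityˡ _ ⟨
  + 1 * (negOnePowℕ n * X (- j))                        ≡⟨ cong (_* (negOnePowℕ n * X (- j))) (negOnePowℕ-square ∣ m ∣) ⟨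
  negOnePow m * negOnePow m * (negOnePowℕ n * X (- j))  ≡⟨ rearrange (negOnePow m) (negOnePowℕ n) (X (- j)) ⟩
  negOnePow m * (negOnePowℕ n * negOnePow m * X (- j))  ≡⟨ cong (λ t → negOnePow m * (t * X (- j))) sign ⟨
  negOnePow m * (negOnePow j * X (- j))                 ≡⟨ cong (negOnePow m *_) (conj j) ⟩
  negOnePow m * Y j                                     ∎
  where
  j = + n - m
  sign : negOnePow j ≡ negOnePowℕ n * negOnePow m
  sign = trans (negOnePow-+ n (- m)) (cong (negOnePowℕ n *_) (negOnePow-neg m))
  neg-minus : ∀ a b → - (a - b) ≡ b - a
  neg-minus = solve-∀
  rearrange : ∀ s t x → s * s * (t * x) ≡ s * (t * s * x)
  rearrange = solve-∀

sumTo-cong : ∀ m {f g : ℕ → ℤ} → (∀ k → f k ≡ g k) → sumTo m f ≡ sumTo m g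
sumTo-cong zero    f≗g = f≗g 0
sumTo-cong (suc m) f≗g = cong₂ _+_ (sumTo-cong m f≗g) (f≗g (suc m))

sumTo-+ : ∀ m (f g : ℕ → ℤ) → sumTo m (λ k → f k + g k) ≡ sumTo m f + sumTo m g
sumTo-+ zero    f g = refl
sumTo-+ (suc m) f g = trans (cong (_+ (f (suc m) + g (suc m))) (sumTo-+ m f g))
                            (interchange (sumTo m f) (sumTo m g) (f (suc m)) (g (suc m)))
  where
  interchange : ∀ a b c d → (a + b) + (c + d) ≡ (a + c) + (b + d)
  interchange = solve-∀

sumTo-*ˡ : ∀ m c (f : ℕ → ℤ) → sumTo m (λ k → c * f k) ≡ c * sumTo m f
sumTo-*ˡ zero    c f = refl
sumTo-*ˡ (suc m) c f = trans (cong (_+ c * f (suc m)) (sumTo-*ˡ m c f))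
                             (sym (ℤₚ.*-distribˡ-+ c (sumTo m f) (f (suc m))))

sumTo-suc : ∀ m (f : ℕ → ℤ) → sumTo (suc m) f ≡ f 0 + sumTo m (f ∘ suc)
sumTo-suc zero    f = refl
sumTo-suc (suc m) f = trans (cong (_+ f (suc (suc m))) (sumTo-suc m f))
                            (ℤₚ.+-assoc (f 0) (sumTo m (f ∘ suc)) (f (suc (suc m))))

sumTo-extend : ∀ m (f : ℕ → ℤ) → f (suc m) ≡ + 0 → sumTo (suc m) f ≡ sumTo m f
sumTo-extend m f f[1+m]≡0 = trans (cong (λ x → sumTo m f + x) f[1+m]≡0) (ℤₚ.+-identityʳ (sumTo m f))

sumTo-vanishing : ∀ {a m} (f : ℕ → ℤ) → (∀ k → a < k → f k ≡ + 0) → a ≤′ m → sumTo m f ≡ sumTo a f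
sumTo-vanishing f vanish ≤′-refl         = refl
sumTo-vanishing f vanish (≤′-step a≤′m) =
  trans (sumTo-extend _ f (vanish _ (s≤s (ℕₚ.≤′⇒≤ a≤′m)))) (sumTo-vanishing f vanish a≤′m)

binom-pascal : ∀ n k → binom (suc n) (suc k) ≡ binom n k + binom n (suc k)
binom-pascal n k = sym (cong +_ (nCk+nC[k+1]≡[n+1]C[k+1] n k))

binom-vanishing : ∀ {n k} → n < k → binom n k ≡ + 0
binom-vanishing n<k = cong +_ (k>n⇒nCk≡0 n<k)

double-suc : ∀ k → 2 ℕ.* suc k ≡ suc (suc (2 ℕ.* k))
double-suc k = ℕₚ.*-suc 2 k

double-suc-ℤ : ∀ k → + (2 ℕ.* suc k) ≡ + 2 + + (2 ℕ.* k)
double-suc-ℤ k = cong +_ (double-suc k)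

n<double-suc : ∀ n → n < 2 ℕ.* suc n
n<double-suc n = ℕₚ.m≤m+n (suc n) (suc n ℕ.+ 0)

⌊n/2⌋<k⇒n<2k : ∀ n k → ⌊ n /2⌋ < k → n < 2 ℕ.* k
⌊n/2⌋<k⇒n<2k zero          (suc k)       _         = s≤s z≤n
⌊n/2⌋<k⇒n<2k (suc zero)    (suc zero)    _         = s≤s (s≤s z≤n)
⌊n/2⌋<k⇒n<2k (suc zero)    (suc (suc k)) _         = s≤s (s≤s z≤n)
⌊n/2⌋<k⇒n<2k (suc (suc n)) (suc k)       (s≤s lt) rewrite double-suc k = s≤s (s≤s (⌊n/2⌋<k⇒n<2k n k lt))

-- The index k runs up to n rather than ⌊n/2⌋; the extra terms vanish as C(n,j) = 0 for j > n.
evenBinomialSum : ℕ → (ℕ → ℤ) → ℤ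
evenBinomialSum n g = sumTo n (λ k → binom n (2 ℕ.* k) * g k)

oddBinomialSum : ℕ → (ℕ → ℤ) → ℤ
oddBinomialSum n g = sumTo n (λ k → binom n (suc (2 ℕ.* k)) * g k)

evenBinomialSum-cong : ∀ n {g h : ℕ → ℤ} → (∀ k → g k ≡ h k) → evenBinomialSum n g ≡ evenBinomialSum n h
evenBinomialSum-cong n g≗h = sumTo-cong n (λ k → cong (binom n (2 ℕ.* k) *_) (g≗h k))

evenBinomialSum-truncate : ∀ n g → sumTo ⌊ n /2⌋ (λ k → binom n (2 ℕ.* k) * g k) ≡ evenBinomialSum n g
evenBinomialSum-truncate n g = sym (sumTo-vanishing _ vanish (ℕₚ.≤⇒≤′ (ℕₚ.⌊n/2⌋≤n n)))
  where
  vanish : ∀ k → ⌊ n /2⌋ < k → binom n (2 ℕ.* k) * g k ≡ + 0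
  vanish k lt = trans (cong (_* g k) (binom-vanishing (⌊n/2⌋<k⇒n<2k n k lt))) (ℤₚ.*-zeroˡ (g k))

evenBinomialSum-zero : ∀ g → evenBinomialSum 0 g ≡ g 0
evenBinomialSum-zero g = ℤₚ.*-identityˡ (g 0)

evenBinomialSum-one : ∀ g → evenBinomialSum 1 g ≡ g 0
evenBinomialSum-one g = drop (g 0) (g 1)
  where
  drop : ∀ a b → + 1 * a + + 0 * b ≡ a
  drop = solve-∀

evenBinomialSum-suc : ∀ n g → evenBinomialSum (suc n) g ≡ evenBinomialSum n g + oddBinomialSum n (g ∘ suc)
evenBinomialSum-suc n g = begin
  evenBinomialSum (suc n) g
    ≡⟨ sumTo-suc n _ ⟩
  binom n 0 * g 0 + sumTo n (λ k → binom (suc n) (2 ℕ.* suc k) * g (suc k))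
    ≡⟨ cong (λ x → binom n 0 * g 0 + x) (trans (sumTo-cong n pascal) (sumTo-+ n _ _)) ⟩
  binom n 0 * g 0 + (sumTo n (λ k → binom n (2 ℕ.* suc k) * g (suc k)) + oddBinomialSum n (g ∘ suc))
    ≡⟨ ℤₚ.+-assoc (binom n 0 * g 0) _ _ ⟨
  binom n 0 * g 0 + sumTo n (λ k → binom n (2 ℕ.* suc k) * g (suc k)) + oddBinomialSum n (g ∘ suc)
    ≡⟨ cong (_+ oddBinomialSum n (g ∘ suc)) (sumTo-suc n _) ⟨
  sumTo (suc n) (λ k → binom n (2 ℕ.* k) * g k) + oddBinomialSum n (g ∘ suc)
    ≡⟨ cong (_+ oddBinomialSum n (g ∘ suc)) (sumTo-extend n _ last) ⟩
  evenBinomialSum n g + oddBinomialSum n (g ∘ suc) ∎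
  where
  pascal : ∀ k → binom (suc n) (2 ℕ.* suc k) * g (suc k)
               ≡ binom n (2 ℕ.* suc k) * g (suc k) + binom n (suc (2 ℕ.* k)) * g (suc k)
  pascal k = begin
    binom (suc n) (2 ℕ.* suc k) * g (suc k)
      ≡⟨ cong (λ j → binom (suc n) j * g (suc k)) (double-suc k) ⟩
    binom (suc n) (suc (suc (2 ℕ.* k))) * g (suc k)
      ≡⟨ cong (_* g (suc k)) (binom-pascal n (suc (2 ℕ.* k))) ⟩
    (binom n (suc (2 ℕ.* k)) + binom n (suc (suc (2 ℕ.* k)))) * g (suc k)
      ≡⟨ cong (λ j → (binom n (suc (2 ℕ.* k)) + binom n j) * g (suc k)) (double-suc k) ⟨
    (binom n (suc (2 ℕ.* k)) + binom n (2 ℕ.* suc k)) * g (suc k)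
      ≡⟨ cong (_* g (suc k)) (ℤₚ.+-comm (binom n (suc (2 ℕ.* k))) (binom n (2 ℕ.* suc k))) ⟩
    (binom n (2 ℕ.* suc k) + binom n (suc (2 ℕ.* k))) * g (suc k)
      ≡⟨ ℤₚ.*-distribʳ-+ (g (suc k)) (binom n (2 ℕ.* suc k)) (binom n (suc (2 ℕ.* k))) ⟩
    binom n (2 ℕ.* suc k) * g (suc k) + binom n (suc (2 ℕ.* k)) * g (suc k) ∎
  last : binom n (2 ℕ.* suc n) * g (suc n) ≡ + 0
  last = trans (cong (_* g (suc n)) (binom-vanishing (n<double-suc n))) (ℤₚ.*-zeroˡ (g (suc n)))

oddBinomialSum-suc : ∀ n g → oddBinomialSum (suc n) g ≡ evenBinomialSum n g + oddBinomialSum n g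
oddBinomialSum-suc n g = begin
  oddBinomialSum (suc n) g
    ≡⟨ sumTo-cong (suc n) pascal ⟩
  sumTo (suc n) (λ k → binom n (2 ℕ.* k) * g k + binom n (suc (2 ℕ.* k)) * g k)
    ≡⟨ sumTo-+ (suc n) _ _ ⟩
  sumTo (suc n) (λ k → binom n (2 ℕ.* k) * g k) + sumTo (suc n) (λ k → binom n (suc (2 ℕ.* k)) * g k)
    ≡⟨ cong₂ _+_ (sumTo-extend n _ (last (n<double-suc n)))
                 (sumTo-extend n _ (last (ℕₚ.m<n⇒m<1+n (n<double-suc n)))) ⟩
  evenBinomialSum n g + oddBinomialSum n g ∎
  where
  pascal : ∀ k → binom (suc n) (suc (2 ℕ.* k)) * g k ≡ binom n (2 ℕ.* k) * g k + binom n (suc (2 ℕ.* k)) * g k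
  pascal k = trans (cong (_* g k) (binom-pascal n (2 ℕ.* k))) (ℤₚ.*-distribʳ-+ (g k) (binom n (2 ℕ.* k)) (binom n (suc (2 ℕ.* k))))
  last : ∀ {j} → n < j → binom n j * g (suc n) ≡ + 0
  last n<j = trans (cong (_* g (suc n)) (binom-vanishing n<j)) (ℤₚ.*-zeroˡ (g (suc n)))

evenBinomialSum-recurrence : ∀ n g →
  evenBinomialSum (suc (suc n)) g
    ≡ + 2 * evenBinomialSum (suc n) g - evenBinomialSum n g + evenBinomialSum n (g ∘ suc)
evenBinomialSum-recurrence n g = begin
  E (suc (suc n)) g                     ≡⟨ evenBinomialSum-suc (suc n) g ⟩
  E (suc n) g + O (suc n) (g ∘ suc)     ≡⟨ cong (λ x → E (suc n) g + x) (oddBinomialSum-suc n (g ∘ suc)) ⟩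
  E (suc n) g + (E n (g ∘ suc) + O n (g ∘ suc))
    ≡⟨ cong (λ x → x + (E n (g ∘ suc) + O n (g ∘ suc))) (evenBinomialSum-suc n g) ⟩
  E n g + O n (g ∘ suc) + (E n (g ∘ suc) + O n (g ∘ suc))
    ≡⟨ rearrange (E n g) (O n (g ∘ suc)) (E n (g ∘ suc)) ⟩
  + 2 * (E n g + O n (g ∘ suc)) - E n g + E n (g ∘ suc)
    ≡⟨ cong (λ x → + 2 * x - E n g + E n (g ∘ suc)) (evenBinomialSum-suc n g) ⟨
  + 2 * E (suc n) g - E n g + E n (g ∘ suc) ∎
  where
  E = evenBinomialSum
  O = oddBinomialSum
  rearrange : ∀ e o e′ → e + o + (e′ + o) ≡ + 2 * (e + o) - e + e′
  rearrange = solve-∀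

record EvenBinomialRecurrence {I : Set} (shift : I → I) (R : ℕ → I → ℤ) : Set where
  constructor evenBinomialRecurrence
  field step : ∀ n i → R (suc (suc n)) i ≡ + 2 * R (suc n) i - R n i + R n (shift i)

open EvenBinomialRecurrence

evenBinomialRecurrence-+ : ∀ {I : Set} {shift : I → I} {R S : ℕ → I → ℤ} →
  EvenBinomialRecurrence shift R → EvenBinomialRecurrence shift S →
  EvenBinomialRecurrence shift (λ n i → R n i + S n i)
evenBinomialRecurrence-+ {shift = shift} {R} {S} recR recS = evenBinomialRecurrence λ n i →
  trans (cong₂ _+_ (step recR n i) (step recS n i))
        (collect (R (suc n) i) (R n i) (R n (shift i)) (S (suc n) i) (S n i) (S n (shift i)))
  where
  collect : ∀ a b c a′ b′ c′ → + 2 * a - b + c + (+ 2 * a′ - b′ + c′) ≡ + 2 * (a + a′) - (b + b′) + (c + c′)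
  collect = solve-∀

evenBinomialSum-solution : ∀ {I : Set} {shift : I → I} {R : ℕ → I → ℤ} (c : ℤ) (g : I → ℕ → ℤ) →
  (∀ i k → g i (suc k) ≡ g (shift i) k) → EvenBinomialRecurrence shift R →
  (∀ i → c * g i 0 ≡ R 0 i) → (∀ i → c * g i 0 ≡ R 1 i) →
  ∀ n i → c * evenBinomialSum n (g i) ≡ R n i
evenBinomialSum-solution {shift = shift} {R} c g g-shift recR base₀ base₁ n = proj₁ (twoSteps n)
  where
  E = evenBinomialSum

  twoSteps : ∀ n → (∀ i → c * E n (g i) ≡ R n i) × (∀ i → c * E (suc n) (g i) ≡ R (suc n) i)
  twoSteps zero    = (λ i → trans (cong (c *_) (evenBinomialSum-zero (g i))) (base₀ i))
                   , (λ i → trans (cong (c *_) (evenBinomialSum-one (g i))) (base₁ i))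
  twoSteps (suc n) with twoSteps n
  ... | ihₙ , ihₙ₊₁ = ihₙ₊₁ , λ i → begin
    c * E (suc (suc n)) (g i)
      ≡⟨ cong (c *_) (evenBinomialSum-recurrence n (g i)) ⟩
    c * (+ 2 * E (suc n) (g i) - E n (g i) + E n (g i ∘ suc))
      ≡⟨ cong (λ e → c * (+ 2 * E (suc n) (g i) - E n (g i) + e)) (evenBinomialSum-cong n (g-shift i)) ⟩
    c * (+ 2 * E (suc n) (g i) - E n (g i) + E n (g (shift i)))
      ≡⟨ distribute c (E (suc n) (g i)) (E n (g i)) (E n (g (shift i))) ⟩
    + 2 * (c * E (suc n) (g i)) - c * E n (g i) + c * E n (g (shift i))
      ≡⟨ cong₂ (λ x y → + 2 * x - y + c * E n (g (shift i))) (ihₙ₊₁ i) (ihₙ i) ⟩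
    + 2 * R (suc n) i - R n i + c * E n (g (shift i))
      ≡⟨ cong (λ x → + 2 * R (suc n) i - R n i + x) (ihₙ (shift i)) ⟩
    + 2 * R (suc n) i - R n i + R n (shift i)
      ≡⟨ step recR n i ⟨
    R (suc (suc n)) i ∎
    where
    distribute : ∀ c a b d → c * (+ 2 * a - b + d) ≡ + 2 * (c * a) - c * b + c * d
    distribute = solve-∀

module _ {X : ℤ → ℤ} (fibX : FibonacciLike X) where

  evenIndexed-recurrence : EvenBinomialRecurrence (λ m → + 2 + m) (λ n m → X (+ (2 ℕ.* n) + m))
  evenIndexed-recurrence = evenBinomialRecurrence unfold
    where
    unfold : ∀ n m → X (+ (2 ℕ.* suc (suc n)) + m)
                   ≡ + 2 * X (+ (2 ℕ.* suc n) + m) - X (+ (2 ℕ.* n) + m) + X (+ (2 ℕ.* n) + (+ 2 + m))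
    unfold n m = let j = + (2 ℕ.* n) + m in begin
      X (+ (2 ℕ.* suc (suc n)) + m)             ≡⟨ cong X index₄ ⟩
      X (+ 4 + j)                               ≡⟨ fibonacciLike-+4 fibX j ⟩
      + 3 * X (+ 1 + j) + + 2 * X j             ≡⟨ rearrange (X (+ 1 + j)) (X j) ⟩
      + 2 * (X (+ 1 + j) + X j) - X j + (X (+ 1 + j) + X j)
        ≡⟨ cong (λ x → + 2 * x - X j + x) (recurrence fibX j) ⟨
      + 2 * X (+ 2 + j) - X j + X (+ 2 + j)
        ≡⟨ cong₂ (λ i i′ → + 2 * X i - X j + X i′) index₂ index₂′ ⟨
      + 2 * X (+ (2 ℕ.* suc n) + m) - X j + X (+ (2 ℕ.* n) + (+ 2 + m)) ∎
      where
      d = + (2 ℕ.* n)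
      shift₄ : ∀ d m → + 2 + (+ 2 + d) + m ≡ + 4 + (d + m)
      shift₄ = solve-∀
      shift₂ : ∀ d m → d + (+ 2 + m) ≡ + 2 + (d + m)
      shift₂ = solve-∀
      index₄ : + (2 ℕ.* suc (suc n)) + m ≡ + 4 + (d + m)
      index₄ = trans (cong (λ i → i + m) (trans (double-suc-ℤ (suc n)) (cong (λ i → + 2 + i) (double-suc-ℤ n))))
                     (shift₄ d m)
      index₂ : + (2 ℕ.* suc n) + m ≡ + 2 + (d + m)
      index₂ = trans (cong (_+ m) (double-suc-ℤ n)) (ℤₚ.+-assoc (+ 2) d m)
      index₂′ : d + (+ 2 + m) ≡ + 2 + (d + m)
      index₂′ = shift₂ d m
      rearrange : ∀ a b → + 3 * a + + 2 * b ≡ + 2 * (a + b) - b + (a + b)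
      rearrange = solve-∀

  reflectedIndexed-recurrence : EvenBinomialRecurrence (λ m → + 2 + m) (λ n m → negOnePowℕ n * X (m - + n))
  reflectedIndexed-recurrence = evenBinomialRecurrence unfold
    where
    unfold : ∀ n m → negOnePowℕ (suc (suc n)) * X (m - + suc (suc n))
                   ≡ + 2 * (negOnePowℕ (suc n) * X (m - + suc n)) - negOnePowℕ n * X (m - + n)
                     + negOnePowℕ n * X (+ 2 + m - + n)
    unfold n m = let s = negOnePowℕ n; j = m - + suc (suc n) in begin
      - - s * X j
        ≡⟨ rearrange s (X (+ 1 + j)) (X j) ⟩
      + 2 * (- s * X (+ 1 + j)) - s * (X (+ 1 + j) + X j) + s * (+ 3 * X (+ 1 + j) + + 2 * X j)
        ≡⟨ cong₂ (λ x y → + 2 * (- s * X (+ 1 + j)) - s * x + s * y) (recurrence fibX j) (fibonacciLike-+4 fibX j) ⟨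
      + 2 * (- s * X (+ 1 + j)) - s * X (+ 2 + j) + s * X (+ 4 + j)
        ≡⟨ cong₂ (λ i i′ → + 2 * (- s * X i) - s * X i′ + s * X (+ 4 + j)) (index₁ m (+ n)) (index₂ m (+ n)) ⟨
      + 2 * (- s * X (m - + suc n)) - s * X (m - + n) + s * X (+ 4 + j)
        ≡⟨ cong (λ i → + 2 * (- s * X (m - + suc n)) - s * X (m - + n) + s * X i) (index₄ m (+ n)) ⟨
      + 2 * (- s * X (m - + suc n)) - s * X (m - + n) + s * X (+ 2 + m - + n) ∎
      where
      rearrange : ∀ s a b → - - s * b ≡ + 2 * (- s * a) - s * (a + b) + s * (+ 3 * a + + 2 * b)
      rearrange = solve-∀
      index₁ : ∀ m i → m - (+ 1 + i) ≡ + 1 + (m - (+ 2 + i))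
      index₁ = solve-∀
      index₂ : ∀ m i → m - i ≡ + 2 + (m - (+ 2 + i))
      index₂ = solve-∀
      index₄ : ∀ m i → + 2 + m - i ≡ + 4 + (m - (+ 2 + i))
      index₄ = solve-∀

  evenBinomialSum-fibonacciLike : ∀ n m →
    + 2 * evenBinomialSum n (λ k → X (+ (2 ℕ.* k) + m)) ≡ X (+ (2 ℕ.* n) + m) + negOnePowℕ n * X (m - + n)
  evenBinomialSum-fibonacciLike =
    evenBinomialSum-solution (+ 2) (λ m k → X (+ (2 ℕ.* k) + m)) shifted
      (evenBinomialRecurrence-+ evenIndexed-recurrence reflectedIndexed-recurrence) base₀ base₁
    where
    shifted : ∀ m k → X (+ (2 ℕ.* suc k) + m) ≡ X (+ (2 ℕ.* k) + (+ 2 + m))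
    shifted m k = cong X (trans (cong (_+ m) (double-suc-ℤ k)) (swap (+ (2 ℕ.* k)) m))
      where
      swap : ∀ d m → + 2 + d + m ≡ d + (+ 2 + m)
      swap = solve-∀
    base₀ : ∀ m → + 2 * X (+ 0 + m) ≡ X (+ 0 + m) + + 1 * X (m - + 0)
    base₀ m = begin
      + 2 * X (+ 0 + m)          ≡⟨ cong (λ i → + 2 * X i) (ℤₚ.+-identityˡ m) ⟩
      + 2 * X m                  ≡⟨ double (X m) ⟩
      X m + + 1 * X m            ≡⟨ cong₂ (λ i i′ → X i + + 1 * X i′) (ℤₚ.+-identityˡ m) (ℤₚ.+-identityʳ m) ⟨
      X (+ 0 + m) + + 1 * X (m - + 0) ∎
      where
      double : ∀ x → + 2 * x ≡ x + + 1 * x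
      double = solve-∀
    base₁ : ∀ m → + 2 * X (+ 0 + m) ≡ X (+ 2 + m) + - + 1 * X (m - + 1)
    base₁ m = let j = m - + 1 in begin
      + 2 * X (+ 0 + m)                      ≡⟨ cong (λ i → + 2 * X i) (ℤₚ.+-identityˡ m) ⟩
      + 2 * X m                              ≡⟨ rearrange (X m) (X j) ⟩
      X m + X j + X m + - + 1 * X j          ≡⟨ cong (λ i → X i + X j + X m + - + 1 * X j) (index₁ m) ⟩
      X (+ 1 + j) + X j + X m + - + 1 * X j  ≡⟨ cong (λ x → x + X m + - + 1 * X j) (recurrence fibX j) ⟨
      X (+ 2 + j) + X m + - + 1 * X j        ≡⟨ cong (λ i → X i + X m + - + 1 * X j) (index₂ m) ⟩
      X (+ 1 + m) + X m + - + 1 * X j        ≡⟨ cong (_+ - + 1 * X j) (recurrence fibX m) ⟨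
      X (+ 2 + m) + - + 1 * X j              ∎
      where
      rearrange : ∀ x y → + 2 * x ≡ x + y + x + - + 1 * y
      rearrange = solve-∀
      index₁ : ∀ m → m ≡ + 1 + (m - + 1)
      index₁ = solve-∀
      index₂ : ∀ m → + 2 + (m - + 1) ≡ + 1 + m
      index₂ = solve-∀

-- (1+i)² = 2i, so Re (1+i)ⁿ⁺² = 2 Re (1+i)ⁿ⁺¹ - 2 Re (1+i)ⁿ.
cosTerm-recurrence : ∀ n → cosTerm (suc (suc n)) ≡ + 2 * cosTerm (suc n) - + 2 * cosTerm n
cosTerm-recurrence n = expand (proj₁ (gpow (+ 1 , + 1) n)) (proj₂ (gpow (+ 1 , + 1) n))
  where
  expand : ∀ x y → + 2 * (+ 1 * (+ 1 * x - + 1 * y) - + 1 * (+ 1 * y + + 1 * x))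
                 ≡ + 2 * (+ 2 * (+ 1 * x - + 1 * y)) - + 2 * (+ 2 * x)
  expand = solve-∀

evenBinomialSum-alternating : ∀ n t → + 2 * evenBinomialSum n (λ k → t * negOnePowℕ k) ≡ t * cosTerm n
evenBinomialSum-alternating =
  evenBinomialSum-solution {shift = -_} (+ 2) (λ t k → t * negOnePowℕ k) (λ t k → neg-swap t (negOnePowℕ k))
    (evenBinomialRecurrence unfold) base base
  where
  neg-swap : ∀ t x → t * - x ≡ - t * x
  neg-swap = solve-∀
  base : ∀ t → + 2 * (t * + 1) ≡ t * + 2
  base = solve-∀
  distribute : ∀ t a b → t * (+ 2 * a - + 2 * b) ≡ + 2 * (t * a) - t * b + - t * b
  distribute = solve-∀
  unfold : ∀ n t → t * cosTerm (suc (suc n)) ≡ + 2 * (t * cosTerm (suc n)) - t * cosTerm n + - t * cosTerm n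
  unfold n t = trans (cong (t *_) (cosTerm-recurrence n)) (distribute t (cosTerm (suc n)) (cosTerm n))

productFormula-diagonal : ∀ (P Q R : ℤ → ℤ) (c σ : ℤ) → (∀ a b → ProductFormula P Q R c σ a b) →
  ∀ r s k → c * (P (+ k + r) * Q (+ k + s))
          ≡ R (+ (2 ℕ.* k) + (r + s)) + σ * (negOnePow s * R (r - s)) * negOnePowℕ k
productFormula-diagonal P Q R c σ product r s k = let a = + k + r; b = + k + s in begin
  c * (P a * Q b)
    ≡⟨ product a b ⟩
  R (a + b) + σ * (negOnePow b * R (a - b))
    ≡⟨ cong₂ (λ i t → R i + σ * (t * R (a - b))) sum-index (negOnePow-+ k s) ⟩
  R (+ (2 ℕ.* k) + (r + s)) + σ * (negOnePowℕ k * negOnePow s * R (a - b))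
    ≡⟨ cong (λ i → R (+ (2 ℕ.* k) + (r + s)) + σ * (negOnePowℕ k * negOnePow s * R i)) (diff-index (+ k) r s) ⟩
  R (+ (2 ℕ.* k) + (r + s)) + σ * (negOnePowℕ k * negOnePow s * R (r - s))
    ≡⟨ cong (λ x → R (+ (2 ℕ.* k) + (r + s)) + x) (rotate σ (negOnePowℕ k) (negOnePow s) (R (r - s))) ⟩
  R (+ (2 ℕ.* k) + (r + s)) + σ * (negOnePow s * R (r - s)) * negOnePowℕ k ∎
  where
  twice : ∀ x r s → x + r + (x + s) ≡ + 2 * x + (r + s)
  twice = solve-∀
  sum-index : + k + r + (+ k + s) ≡ + (2 ℕ.* k) + (r + s)
  sum-index = trans (twice (+ k) r s) (cong (_+ (r + s)) (sym (ℤₚ.pos-* 2 k)))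
  diff-index : ∀ x r s → x + r - (x + s) ≡ r - s
  diff-index = solve-∀
  rotate : ∀ σ t u v → σ * (t * u * v) ≡ σ * (u * v) * t
  rotate = solve-∀

evenBinomialProductSum : ∀ (P Q R Y : ℤ → ℤ) (c σ : ℤ) → FibonacciLike R →
  (∀ a b → ProductFormula P Q R c σ a b) → (∀ j → negOnePow j * R (- j) ≡ Y j) →
  ∀ n r s → + 2 * c * sumTo ⌊ n /2⌋ (λ k → binom n (2 ℕ.* k) * P (+ k + r) * Q (+ k + s))
          ≡ R (+ (2 ℕ.* n) + r + s) + negOnePow (r + s) * Y (+ n - r - s)
            + σ * (negOnePow s * cosTerm n * R (r - s))
evenBinomialProductSum P Q R Y c σ fibR product conj n r s = begin
  + 2 * c * sumTo ⌊ n /2⌋ term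
    ≡⟨ ℤₚ.*-assoc (+ 2) c (sumTo ⌊ n /2⌋ term) ⟩
  + 2 * (c * sumTo ⌊ n /2⌋ term)
    ≡⟨ cong (+ 2 *_) (sumTo-*ˡ ⌊ n /2⌋ c term) ⟨
  + 2 * sumTo ⌊ n /2⌋ (λ k → c * term k)
    ≡⟨ cong (+ 2 *_) (trans (sumTo-cong ⌊ n /2⌋ split) (sumTo-+ ⌊ n /2⌋ _ _)) ⟩
  + 2 * (sumTo ⌊ n /2⌋ (λ k → binom n (2 ℕ.* k) * R (+ (2 ℕ.* k) + m))
         + sumTo ⌊ n /2⌋ (λ k → binom n (2 ℕ.* k) * (K * negOnePowℕ k)))
    ≡⟨ cong₂ (λ x y → + 2 * (x + y)) (evenBinomialSum-truncate n _) (evenBinomialSum-truncate n _) ⟩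
  + 2 * (evenBinomialSum n (λ k → R (+ (2 ℕ.* k) + m)) + evenBinomialSum n (λ k → K * negOnePowℕ k))
    ≡⟨ ℤₚ.*-distribˡ-+ (+ 2) (evenBinomialSum n (λ k → R (+ (2 ℕ.* k) + m)))
                              (evenBinomialSum n (λ k → K * negOnePowℕ k)) ⟩
  + 2 * evenBinomialSum n (λ k → R (+ (2 ℕ.* k) + m)) + + 2 * evenBinomialSum n (λ k → K * negOnePowℕ k)
    ≡⟨ cong₂ _+_ (evenBinomialSum-fibonacciLike fibR n m) (evenBinomialSum-alternating n K) ⟩
  R (+ (2 ℕ.* n) + m) + negOnePowℕ n * R (m - + n) + K * cosTerm n
    ≡⟨ cong₂ (λ i x → R i + x + K * cosTerm n)
             (sym (ℤₚ.+-assoc (+ (2 ℕ.* n)) r s)) (conjugate-reflection {R} {Y} conj n m) ⟩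
  R (+ (2 ℕ.* n) + r + s) + negOnePow m * Y (+ n - m) + K * cosTerm n
    ≡⟨ cong₂ (λ i x → R (+ (2 ℕ.* n) + r + s) + negOnePow m * Y i + x)
             (minus-+ (+ n) r s) (rotate σ (negOnePow s) (R (r - s)) (cosTerm n)) ⟩
  R (+ (2 ℕ.* n) + r + s) + negOnePow m * Y (+ n - r - s) + σ * (negOnePow s * cosTerm n * R (r - s)) ∎
  where
  m = r + s
  K = σ * (negOnePow s * R (r - s))
  term : ℕ → ℤ
  term k = binom n (2 ℕ.* k) * P (+ k + r) * Q (+ k + s)
  pull : ∀ c B p q → c * (B * p * q) ≡ B * (c * (p * q))
  pull = solve-∀
  split : ∀ k → c * term k ≡ binom n (2 ℕ.* k) * R (+ (2 ℕ.* k) + m) + binom n (2 ℕ.* k) * (K * negOnePowℕ k)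
  split k = let B = binom n (2 ℕ.* k) in begin
    c * (B * P (+ k + r) * Q (+ k + s))                 ≡⟨ pull c B (P (+ k + r)) (Q (+ k + s)) ⟩
    B * (c * (P (+ k + r) * Q (+ k + s)))               ≡⟨ cong (B *_) (productFormula-diagonal P Q R c σ product r s k) ⟩
    B * (R (+ (2 ℕ.* k) + m) + K * negOnePowℕ k)        ≡⟨ ℤₚ.*-distribˡ-+ B (R (+ (2 ℕ.* k) + m)) (K * negOnePowℕ k) ⟩
    B * R (+ (2 ℕ.* k) + m) + B * (K * negOnePowℕ k)    ∎
  minus-+ : ∀ a r s → a - (r + s) ≡ a - r - s
  minus-+ = solve-∀
  rotate : ∀ σ t v c → σ * (t * v) * c ≡ σ * (t * c * v)
  rotate = solve-∀

theorem25 : (n : ℕ) (r s : ℤ) →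
    (+ 10 * sumTo ⌊ n /2⌋ (λ k → binom n (2 ℕ.* k) * F (+ k + r) * F (+ k + s))
      ≡ L (+ (2 ℕ.* n) + r + s) + negOnePow (r + s) * L (+ n - r - s)
        - negOnePow s * cosTerm n * L (r - s))
    × (+ 2 * sumTo ⌊ n /2⌋ (λ k → binom n (2 ℕ.* k) * L (+ k + r) * F (+ k + s))
      ≡ F (+ (2 ℕ.* n) + r + s) - negOnePow (r + s) * F (+ n - r - s)
        - negOnePow s * cosTerm n * F (r - s))
    × (+ 2 * sumTo ⌊ n /2⌋ (λ k → binom n (2 ℕ.* k) * L (+ k + r) * L (+ k + s))
      ≡ L (+ (2 ℕ.* n) + r + s) + negOnePow (r + s) * L (+ n - r - s)
        + negOnePow s * cosTerm n * L (r - s))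
theorem25 n r s =
    trans (evenBinomialProductSum F F L L (+ 5) (- + 1) fibonacciLike-L FF-product L-conjugate n r s)
          (cong (λ x → L (+ (2 ℕ.* n) + r + s) + negOnePow (r + s) * L (+ n - r - s) + x) (ℤₚ.-1*i≡-i _))
  , trans (evenBinomialProductSum L F F (λ j → - F j) (+ 1) (- + 1) fibonacciLike-F LF-product F-conjugate n r s)
          (cong₂ (λ x y → F (+ (2 ℕ.* n) + r + s) + x + y)
                 (sym (ℤₚ.neg-distribʳ-* (negOnePow (r + s)) _)) (ℤₚ.-1*i≡-i _))
  , trans (evenBinomialProductSum L L L L (+ 1) (+ 1) fibonacciLike-L LL-product L-conjugate n r s)
          (cong (λ x → L (+ (2 ℕ.* n) + r + s) + negOnePow (r + s) * L (+ n - r - s) + x) (ℤₚ.*-identityˡ _))
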